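{- Let $\Gamma$ be a connected graph, and let $n\geq 3$ be an integer. Then $\Gamma\cong\Delta\times C_n$ for some graph $\Delta$ if and only if $V(\Gamma)$ has a partition $\{L_1,\ldots,L_n\}$ into independent sets and a partition $\mathcal{P}$ such that: (a) $|P\cap L_i|=1$ for all $P\in\mathcal{P}$ and $i\in\{1,\ldots,n\}$; (b) for $P_u,P_v\in\mathcal{P}$ and $i,j\in\{1,\ldots,n\}$, if there exist an edge of $\Gamma$ from $P_u$ to $P_v$ and an edge of $\Gamma$ from $L_i$ to $L_j$, then there exists an edge of $\Gamma$ from $P_u\cap L_i$ to $P_v\cap L_j$; (c) for each given $P_u,P_v\in\mathcal{P}$, the number $|N_\Gamma(x)\cap P_v|$ is the same constant $d_{u,v}$ for all $x\in P_u$, and $d_{u,v}\in\{0,2\}$.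
   Context: All graphs are finite, undirected, without multiple edges, but possibly with loops (an independent set contains no two adjacent vertices and no vertex with a loop); $C_n$ is the cycle of length $n$. The direct product $\Delta\times\Sigma$ has vertex set $V(\Delta)\times V(\Sigma)$, with $(u,i)\sim(v,j)$ iff $u\sim v$ in $\Delta$ and $i\sim j$ in $\Sigma$. -}

module Defs where

open import Data.Nat using (ℕ; zero; suc; _*_; _≥_)
open import Data.Bool using (Bool; true; false; _∧_; _∨_)
open import Data.Fin using (Fin; toℕ)
open import Data.Fin.Properties using (*↔×)
import Data.Fin as F
open import Data.List using (List; length; filterᵇ; map)
open import Data.List using () renaming (allFin to allFinL)
open import Data.Product using (Σ; _×_; _,_; ∃)
open import Data.Product.Function.NonDependent.Propositional using (_×-↔_)
open import Function.Bundles using (_↔_; Inverse)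
open import Function.Construct.Composition using (_↔-∘_)
open import Function.Construct.Identity using (↔-id)
open import Relation.Binary.PropositionalEquality using (_≡_; refl; cong₂)
open import Data.Sum using (_⊎_)
open import Data.Nat using (_≡ᵇ_)
open import Relation.Nullary.Decidable using (⌊_⌋)

-- A finite undirected graph, possibly with loops, no multiple edges:
-- a vertex type V enumerated by Fin size, and a symmetric Bool adjacency.
record Graph : Set₁ where
  field
    V    : Set
    size : ℕ
    enum : Fin size ↔ V
    adj  : V → V → Bool
    adj-sym : ∀ x y → adj x y ≡ adj y x
open Graph public

vertices : (G : Graph) → List (V G)
vertices G = map (Inverse.to (enum G)) (allFinL (size G))

-- cycle C_n on Fin n (intended for n ≥ 3): i ~ j iff j ≡ i+1 or i ≡ j+1 (mod n)
cycAdj : (n : ℕ) → Fin n → Fin n → Bool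
cycAdj n i j =
  (suc (toℕ i) ≡ᵇ toℕ j) ∨ (suc (toℕ j) ≡ᵇ toℕ i)
  ∨ ((suc (toℕ i) ≡ᵇ n) ∧ (toℕ j ≡ᵇ 0))
  ∨ ((suc (toℕ j) ≡ᵇ n) ∧ (toℕ i ≡ᵇ 0))

cycAdj-sym : ∀ n (i j : Fin n) → cycAdj n i j ≡ cycAdj n j i
cycAdj-sym n i j
  with suc (toℕ i) ≡ᵇ toℕ j | suc (toℕ j) ≡ᵇ toℕ i
     | (suc (toℕ i) ≡ᵇ n) ∧ (toℕ j ≡ᵇ 0) | (suc (toℕ j) ≡ᵇ n) ∧ (toℕ i ≡ᵇ 0)
... | true  | true  | c | d = refl
... | true  | false | c | d = refl
... | false | true  | c | d = refl
... | false | false | true  | true  = refl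
... | false | false | true  | false = refl
... | false | false | false | true  = refl
... | false | false | false | false = refl

C : ℕ → Graph
C n = record
  { V = Fin n ; size = n ; enum = ↔-id (Fin n)
  ; adj = cycAdj n ; adj-sym = cycAdj-sym n }

_⊗_ : Graph → Graph → Graph
Δ ⊗ S = record
  { V = V Δ × V S
  ; size = size Δ * size S
  ; enum = (enum Δ ×-↔ enum S) ↔-∘ *↔×
  ; adj = λ { (u , i) (v , j) → adj Δ u v ∧ adj S i j }
  ; adj-sym = λ { (u , i) (v , j) → cong₂ _∧_ (adj-sym Δ u v) (adj-sym S i j) } }

_≅_ : Graph → Graph → Set
G ≅ H = Σ (V G ↔ V H) λ f → ∀ x y → adj G x y ≡ adj H (Inverse.to f x) (Inverse.to f y)

-- walks and connectedness (connected graphs are nonempty)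
data Walk (G : Graph) : V G → V G → Set where
  here : ∀ {x} → Walk G x x
  step : ∀ {x y z} → adj G x y ≡ true → Walk G y z → Walk G x z

Connected : Graph → Set
Connected G = V G × (∀ x y → Walk G x y)

nbrCount : (G : Graph) {k : ℕ} → (V G → Fin k) → V G → Fin k → ℕ
nbrCount G P x q = length (filterᵇ (λ y → adj G x y ∧ ⌊ P y F.≟ q ⌋) (vertices G))

-- the right-hand side condition of the lemma, with L : V → Fin n the labelling
-- of the partition {L_1..L_n} and P : V → Fin k the labelling of the partition 𝒫
Decomposition : (G : Graph) (n : ℕ) → Set
Decomposition G n =
  Σ (V G → Fin n) λ L → Σ ℕ λ k → Σ (V G → Fin k) λ P →
    (∀ x y → L x ≡ L y → adj G x y ≡ false)
    -- (a) |P ∩ L_i| = 1 (this also forces every part of 𝒫 and of L to be nonempty)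
  × (∀ p i → Σ (V G) λ x → (P x ≡ p × L x ≡ i) × (∀ y → P y ≡ p → L y ≡ i → y ≡ x))
  × (∀ p q i j →
       (Σ (V G) λ x → Σ (V G) λ y → P x ≡ p × P y ≡ q × adj G x y ≡ true) →
       (Σ (V G) λ x → Σ (V G) λ y → L x ≡ i × L y ≡ j × adj G x y ≡ true) →
       Σ (V G) λ x → Σ (V G) λ y →
         (P x ≡ p × L x ≡ i) × (P y ≡ q × L y ≡ j) × adj G x y ≡ true)
  × (∀ p q → Σ ℕ λ d → (d ≡ 0 ⊎ d ≡ 2) × (∀ x → P x ≡ p → nbrCount G P x q ≡ d))

-- Forward: in Δ × C_n take L_i = V(Δ) × {i} and 𝒫 = the fibres {u} × C_n; a vertex (u, i)
-- has, in the fibre of v, the two neighbours (v, i ± 1) if u ~ v and none otherwise.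
--
-- Backward: by (a), x ↦ (P x, L x) is a bijection onto 𝒫 × {L_1, …, L_n}, and by (b) it is
-- an isomorphism onto the product Γ/𝒫 × Γ/L of the two quotient graphs. Γ/L is connected
-- since Γ is, loopless since each L_i is independent, and 2-regular: a vertex x has a
-- neighbour y, hence by (c) exactly two neighbours in the class of y, and by (b) their labels
-- are all the neighbours of L x. A connected loopless 2-regular graph is a cycle: walking
-- away from a vertex, never turning back, the first repeated vertex is the start, and the
-- vertices visited by then are closed under adjacency.

module Submission where

open import Defs
open import Data.Nat using (ℕ; _≥_)
open import Data.Product using (Σ)
open import Function.Bundles using (_⇔_)

open import Data.Nat as ℕ using (zero; suc; pred; _≤_; _<_; _≡ᵇ_; z≤n; s≤s)
import Data.Nat.Properties as ℕ
open import Data.Bool as Bool using (Bool; true; false; _∧_; _∨_)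
open import Data.Bool.Properties using (T-≡; ⇔→≡; ¬-not)
open import Data.Empty using (⊥-elim)
open import Data.Fin as Fin using (Fin; toℕ; fromℕ; fromℕ<; inject₁; punchIn)
open import Data.Fin.Properties
  using ( toℕ-injective; toℕ<n; toℕ-fromℕ; toℕ-fromℕ<; toℕ-inject₁; toℕ≤pred[n]′; punchInᵢ≢i
        ; injective⇒≤; any?; nonZeroIndex)
open import Data.List using (List; []; _∷_; length; filterᵇ)
open import Data.List.Membership.Propositional using (_∈_; _∉_)
open import Data.List.Membership.Propositional.Properties using (∈-filter⁺; ∈-filter⁻; ∈-map⁺; ∈-allFin)
open import Data.List.Relation.Unary.Any using (here; there)
open import Data.List.Relation.Unary.All as All using ([]; _∷_)
open import Data.List.Relation.Unary.AllPairs using (_∷_)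
open import Data.List.Relation.Unary.Unique.Propositional using (Unique)
import Data.List.Relation.Unary.Unique.Propositional.Properties as Unique
open import Data.Product using (_×_; _,_; proj₁; proj₂)
open import Data.Product.Function.NonDependent.Propositional using (_×-↔_)
open import Data.Sum as Sum using (_⊎_; inj₁; inj₂)
open import Function using (_∘_)
open import Function.Bundles using (_↔_; Inverse; Injection; Equivalence; mk⇔; mk↔ₛ′)
open import Function.Construct.Composition using (_↔-∘_)
open import Function.Construct.Identity using (↔-id)
open import Function.Construct.Symmetry using (↔-sym)
open import Function.Properties.Inverse using (↔⇒↣)
open import Relation.Binary.Definitions using (DecidableEquality)
open import Relation.Binary.PropositionalEquality
open import Relation.Nullary using (¬_; Dec; yes; no)
open import Relation.Nullary.Decidable using (⌊_⌋; _×-dec_; T?; via-injection)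

open Equivalence using (to; from)

∨-true⁻ : ∀ x {y} → x ∨ y ≡ true → x ≡ true ⊎ y ≡ true
∨-true⁻ true  _ = inj₁ refl
∨-true⁻ false e = inj₂ e

∨-true⁺ˡ : ∀ {x} y → x ≡ true → x ∨ y ≡ true
∨-true⁺ˡ _ refl = refl

∨-true⁺ʳ : ∀ x {y} → y ≡ true → x ∨ y ≡ true
∨-true⁺ʳ true  _ = refl
∨-true⁺ʳ false e = e

∧-true⁻ : ∀ x {y} → x ∧ y ≡ true → x ≡ true × y ≡ true
∧-true⁻ true e = refl , e

∧-true⁺ : ∀ {x y} → x ≡ true → y ≡ true → x ∧ y ≡ true
∧-true⁺ refl refl = refl

≡ᵇ-true⁻ : ∀ {m n} → (m ≡ᵇ n) ≡ true → m ≡ n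
≡ᵇ-true⁻ {m} {n} = ℕ.≡ᵇ⇒≡ m n ∘ from T-≡

≡ᵇ-true⁺ : ∀ {m n} → m ≡ n → (m ≡ᵇ n) ≡ true
≡ᵇ-true⁺ {m} {n} = to T-≡ ∘ ℕ.≡⇒≡ᵇ m n

isYes⇔ : ∀ {A : Set} (a? : Dec A) → ⌊ a? ⌋ ≡ true ⇔ A
isYes⇔ (yes a) = mk⇔ (λ _ → a) (λ _ → refl)
isYes⇔ (no ¬a) = mk⇔ (λ ()) (⊥-elim ∘ ¬a)

record ExactlyTwo {A : Set} (P : A → Set) : Set where
  field
    x₁ x₂   : A
    x₁≢x₂   : x₁ ≢ x₂
    px₁     : P x₁
    px₂     : P x₂
    exhaust : ∀ {x} → P x → x ≡ x₁ ⊎ x ≡ x₂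

module _ {A : Set} {P : A → Set} (two : ExactlyTwo P) where
  open ExactlyTwo two

  exactlyTwo-other : ∀ {a} → P a → Σ A λ b → P b × b ≢ a × (∀ {x} → P x → x ≡ a ⊎ x ≡ b)
  exactlyTwo-other pa with exhaust pa
  ... | inj₁ refl = x₂ , px₂ , x₁≢x₂ ∘ sym , exhaust
  ... | inj₂ refl = x₁ , px₁ , x₁≢x₂ , Sum.swap ∘ exhaust

  exactlyTwo-exhaustedBy : ∀ {a b} → P a → P b → a ≢ b → ∀ {x} → P x → x ≡ a ⊎ x ≡ b
  exactlyTwo-exhaustedBy pa pb a≢b px with exactlyTwo-other pa
  ... | _ , _ , _ , exhaust′ with exhaust′ pb
  ...   | inj₁ b≡a  = ⊥-elim (a≢b (sym b≡a))
  ...   | inj₂ refl = exhaust′ px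

exactlyTwo-image : ∀ {A B : Set} {Q : A → Set} {P : B → Set} (f : A → B) →
  (∀ {a a′} → Q a → Q a′ → f a ≡ f a′ → a ≡ a′) →
  (∀ {a} → Q a → P (f a)) →
  (∀ {b} → P b → Σ A λ a → Q a × f a ≡ b) →
  ExactlyTwo Q → ExactlyTwo P
exactlyTwo-image {Q = Q} f injective preserves onto two = record
  { x₁ = f x₁ ; x₂ = f x₂
  ; x₁≢x₂ = x₁≢x₂ ∘ injective px₁ px₂
  ; px₁ = preserves px₁ ; px₂ = preserves px₂
  ; exhaust = λ pb → image-exhaust (onto pb)
  }
  where
  open ExactlyTwo two
  image-exhaust : ∀ {b} → Σ _ (λ a → Q a × f a ≡ b) → b ≡ f x₁ ⊎ b ≡ f x₂
  image-exhaust (a , qa , refl) = Sum.map (cong f) (cong f) (exhaust qa)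

exactlyTwo-resp : ∀ {A : Set} {Q P : A → Set} →
  (∀ {a} → Q a → P a) → (∀ {a} → P a → Q a) → ExactlyTwo Q → ExactlyTwo P
exactlyTwo-resp Q⇒P P⇒Q = exactlyTwo-image (λ a → a) (λ _ _ e → e) Q⇒P (λ pb → _ , P⇒Q pb , refl)

module _ {A : Set} where

  length≡0⇔ : (ys : List A) → length ys ≡ 0 ⇔ (∀ y → y ∉ ys)
  length≡0⇔ []      = mk⇔ (λ _ _ ()) (λ _ → refl)
  length≡0⇔ (y ∷ _) = mk⇔ (λ ()) (λ ∉ys → ⊥-elim (∉ys y (here refl)))

  unique-length≡1 : ∀ {b} {ys : List A} → Unique ys → (∀ {z} → z ∈ ys → z ≡ b) → b ∈ ys → length ys ≡ 1
  unique-length≡1 {ys = _ ∷ []}    _                 _    _ = refl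
  unique-length≡1 {ys = _ ∷ _ ∷ _} ((y≢z ∷ _) ∷ _) only _ =
    ⊥-elim (y≢z (trans (only (here refl)) (sym (only (there (here refl))))))

  unique-length≡2⇔ : {ys : List A} → Unique ys → length ys ≡ 2 ⇔ ExactlyTwo (_∈ ys)
  unique-length≡2⇔ u = mk⇔ (length≡2⇒ u) (⇒length≡2 u)
    where
    length≡2⇒ : ∀ {ys} → Unique ys → length ys ≡ 2 → ExactlyTwo (_∈ ys)
    length≡2⇒ {a ∷ b ∷ []} ((a≢b ∷ []) ∷ _) refl = record
      { x₁ = a ; x₂ = b ; x₁≢x₂ = a≢b ; px₁ = here refl ; px₂ = there (here refl)
      ; exhaust = λ { (here e) → inj₁ e ; (there (here e)) → inj₂ e ; (there (there ())) } }

    ⇒length≡2 : ∀ {ys} → Unique ys → ExactlyTwo (_∈ ys) → length ys ≡ 2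
    ⇒length≡2 {[]} _ two with () ← ExactlyTwo.px₁ two
    ⇒length≡2 {y ∷ ys} (y∉ys ∷ u) two with exactlyTwo-other two (here refl)
    ... | b , b∈ , b≢y , exhaust = cong suc (unique-length≡1 u only-b (in-tail b∈))
      where
      only-b : ∀ {z} → z ∈ ys → z ≡ b
      only-b z∈ys with exhaust (there z∈ys)
      ... | inj₁ refl = ⊥-elim (All.lookup y∉ys z∈ys refl)
      ... | inj₂ z≡b  = z≡b
      in-tail : b ∈ y ∷ ys → b ∈ ys
      in-tail (here b≡y) = ⊥-elim (b≢y b≡y)
      in-tail (there b∈ys) = b∈ys

∈-filterᵇ⇔ : ∀ {A : Set} {xs : List A} → (∀ x → x ∈ xs) → (g : A → Bool) →
  ∀ {y} → y ∈ filterᵇ g xs ⇔ g y ≡ true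
∈-filterᵇ⇔ {xs = xs} complete g =
  mk⇔ (to T-≡ ∘ proj₂ ∘ ∈-filter⁻ (T? ∘ g) {xs = xs}) (∈-filter⁺ (T? ∘ g) (complete _) ∘ from T-≡)

Adj : (G : Graph) → V G → V G → Set
Adj G x y = adj G x y ≡ true

Loopless : Graph → Set
Loopless G = ∀ x → adj G x x ≡ false

TwoRegular : Graph → Set
TwoRegular G = ∀ x → ExactlyTwo (Adj G x)

Adj-sym : (G : Graph) → ∀ {x y} → Adj G x y → Adj G y x
Adj-sym G {x} {y} = trans (adj-sym G y x)

vertex-≟ : (G : Graph) → DecidableEquality (V G)
vertex-≟ G = via-injection (↔⇒↣ (↔-sym (enum G))) Fin._≟_

vertex-any? : (G : Graph) {Q : V G → Set} → (∀ x → Dec (Q x)) → Dec (Σ (V G) Q)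
vertex-any? G {Q} Q? with any? (Q? ∘ Inverse.to (enum G))
... | yes (i , q) = yes (_ , q)
... | no ¬q = no λ (x , q) →
  ¬q (Inverse.from (enum G) x , subst Q (sym (Inverse.strictlyInverseˡ (enum G) x)) q)

vertices-unique : (G : Graph) → Unique (vertices G)
vertices-unique G = Unique.map⁺ (Injection.injective (↔⇒↣ (enum G))) (Unique.allFin⁺ (size G))

∈-vertices : (G : Graph) → ∀ x → x ∈ vertices G
∈-vertices G x = subst (_∈ vertices G) (Inverse.strictlyInverseˡ (enum G) x)
                       (∈-map⁺ (Inverse.to (enum G)) (∈-allFin _))

NbrIn : (G : Graph) {k : ℕ} → (V G → Fin k) → V G → Fin k → V G → Set
NbrIn G P x q y = Adj G x y × P y ≡ q

module _ (G : Graph) {k : ℕ} (P : V G → Fin k) (x : V G) (q : Fin k) where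
  private
    isNbr : V G → Bool
    isNbr y = adj G x y ∧ ⌊ P y Fin.≟ q ⌋

    nbrs⇔ : ∀ {y} → y ∈ filterᵇ isNbr (vertices G) ⇔ NbrIn G P x q y
    nbrs⇔ {y} = mk⇔
      (λ m → let a , b = ∧-true⁻ _ (to (∈-filterᵇ⇔ (∈-vertices G) isNbr) m) in a , to (isYes⇔ _) b)
      (λ (a , b) → from (∈-filterᵇ⇔ (∈-vertices G) isNbr) (∧-true⁺ a (from (isYes⇔ (P y Fin.≟ q)) b)))

    nbrs-unique : Unique (filterᵇ isNbr (vertices G))
    nbrs-unique = Unique.filter⁺ (T? ∘ isNbr) (vertices-unique G)

  nbrCount≡0⇔ : nbrCount G P x q ≡ 0 ⇔ (∀ y → ¬ NbrIn G P x q y)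
  nbrCount≡0⇔ = mk⇔ (λ c y → to (length≡0⇔ _) c y ∘ from nbrs⇔)
                    (λ none → from (length≡0⇔ _) λ y → none y ∘ to nbrs⇔)

  nbrCount≡2⇔ : nbrCount G P x q ≡ 2 ⇔ ExactlyTwo (NbrIn G P x q)
  nbrCount≡2⇔ = mk⇔ (exactlyTwo-resp (to nbrs⇔) (from nbrs⇔) ∘ to (unique-length≡2⇔ nbrs-unique))
                    (from (unique-length≡2⇔ nbrs-unique) ∘ exactlyTwo-resp (from nbrs⇔) (to nbrs⇔))

walk-closed : (G : Graph) {Q : V G → Set} → (∀ {x y} → Adj G x y → Q x → Q y) →
  ∀ {x y} → Walk G x y → Q x → Q y
walk-closed G closed here       q = q
walk-closed G closed (step e w) q = walk-closed G closed w (closed e q)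

walk-map : (G H : Graph) (f : V G → V H) → (∀ x y → Adj G x y → Adj H (f x) (f y)) →
  ∀ {x y} → Walk G x y → Walk H (f x) (f y)
walk-map G H f hom here       = here
walk-map G H f hom (step e w) = step (hom _ _ e) (walk-map G H f hom w)

walk-first-step : (G : Graph) → ∀ {x y} → Walk G x y → x ≢ y → Σ (V G) (Adj G x)
walk-first-step G here         x≢x = ⊥-elim (x≢x refl)
walk-first-step G (step e _) _   = _ , e

loopless⇒¬Adj : (G : Graph) → Loopless G → ∀ {x} → ¬ Adj G x x
loopless⇒¬Adj G loopless {x} e with () ← trans (sym e) (loopless x)

≅-sym : ∀ {G H} → G ≅ H → H ≅ G
≅-sym {G} {H} (f , pres) = ↔-sym f , λ x y → sym (begin
  adj G (from′ x) (from′ y)               ≡⟨ pres (from′ x) (from′ y) ⟩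
  adj H (to′ (from′ x)) (to′ (from′ y))   ≡⟨ cong₂ (adj H) (strictlyInverseˡ x) (strictlyInverseˡ y) ⟩
  adj H x y                               ∎)
  where
  open ≡-Reasoning
  open Inverse f renaming (to to to′; from to from′)

≅-trans : ∀ {G H K} → G ≅ H → H ≅ K → G ≅ K
≅-trans (f , f-pres) (g , g-pres) = (g ↔-∘ f) , λ x y → trans (f-pres x y) (g-pres _ _)

⊗-congʳ : ∀ {Δ H H′} → H ≅ H′ → (Δ ⊗ H) ≅ (Δ ⊗ H′)
⊗-congʳ {Δ} (f , pres) = (↔-id _ ×-↔ f) , λ (u , i) (v , j) → cong (adj Δ u v ∧_) (pres i j)

Precedes : ℕ → ℕ → ℕ → Set
Precedes n a b = suc a ≡ b ⊎ (suc a ≡ n × b ≡ 0)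

precedes-functionalˡ : ∀ {n a a′ b} → Precedes n a b → Precedes n a′ b → a ≡ a′
precedes-functionalˡ (inj₁ refl)          (inj₁ refl)     = refl
precedes-functionalˡ (inj₁ refl)          (inj₂ (_ , ()))
precedes-functionalˡ (inj₂ (_ , refl))    (inj₁ ())
precedes-functionalˡ (inj₂ (refl , refl)) (inj₂ (e , _))  = sym (ℕ.suc-injective e)

precedes-functionalʳ : ∀ {n a b b′} → b < n → b′ < n → Precedes n a b → Precedes n a b′ → b ≡ b′
precedes-functionalʳ _   _    (inj₁ refl)       (inj₁ refl)       = refl
precedes-functionalʳ b<n _    (inj₁ refl)       (inj₂ (refl , _)) = ⊥-elim (ℕ.<-irrefl refl b<n)
precedes-functionalʳ _   b′<n (inj₂ (refl , _)) (inj₁ refl)       = ⊥-elim (ℕ.<-irrefl refl b′<n)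
precedes-functionalʳ _   _    (inj₂ (_ , refl)) (inj₂ (_ , refl)) = refl

precedes-irrefl : ∀ {n a} → 2 ≤ n → ¬ Precedes n a a
precedes-irrefl _             (inj₁ e)           = ℕ.1+n≢n e
precedes-irrefl (s≤s (s≤s _)) (inj₂ (refl , ()))

precedes-asym : ∀ {n a b} → 3 ≤ n → Precedes n a b → ¬ Precedes n b a
precedes-asym _                   (inj₁ refl)         (inj₁ e)           = ℕ.m≢1+n+m _ (sym e)
precedes-asym (s≤s (s≤s (s≤s _))) (inj₁ refl)         (inj₂ (refl , ()))
precedes-asym (s≤s (s≤s (s≤s _))) (inj₂ (refl , refl)) (inj₁ ())
precedes-asym (s≤s (s≤s (s≤s _))) (inj₂ (refl , refl)) (inj₂ (_ , ()))

prev : ∀ {n} → Fin n → Fin n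
prev {suc m} Fin.zero = fromℕ m
prev (Fin.suc i)      = inject₁ i

prev-precedes : ∀ {n} (i : Fin n) → Precedes n (toℕ (prev i)) (toℕ i)
prev-precedes {suc m} Fin.zero = inj₂ (cong suc (toℕ-fromℕ m) , refl)
prev-precedes (Fin.suc i)      = inj₁ (cong suc (toℕ-inject₁ i))

next : ∀ {n} → Fin n → Fin n
next {suc m} i with suc (toℕ i) ℕ.<? suc m
... | yes lt = fromℕ< lt
... | no _   = Fin.zero

next-precedes : ∀ {n} (i : Fin n) → Precedes n (toℕ i) (toℕ (next i))
next-precedes {suc m} i with suc (toℕ i) ℕ.<? suc m
... | yes lt = inj₁ (sym (toℕ-fromℕ< lt))
... | no ¬lt = inj₂ (ℕ.≤-antisym (toℕ<n i) (ℕ.≮⇒≥ ¬lt) , refl)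

precedes⇒≡prev : ∀ {n} {i j : Fin n} → Precedes n (toℕ i) (toℕ j) → i ≡ prev j
precedes⇒≡prev {j = j} p = toℕ-injective (precedes-functionalˡ p (prev-precedes j))

precedes⇒≡next : ∀ {n} {i j : Fin n} → Precedes n (toℕ i) (toℕ j) → j ≡ next i
precedes⇒≡next {i = i} {j} p =
  toℕ-injective (precedes-functionalʳ (toℕ<n j) (toℕ<n (next i)) p (next-precedes i))

cycAdj-true⁻ : ∀ {n} (i j : Fin n) → cycAdj n i j ≡ true →
  Precedes n (toℕ i) (toℕ j) ⊎ Precedes n (toℕ j) (toℕ i)
cycAdj-true⁻ i j e with ∨-true⁻ _ e
... | inj₁ a = inj₁ (inj₁ (≡ᵇ-true⁻ a))
... | inj₂ e′ with ∨-true⁻ _ e′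
...   | inj₁ b = inj₂ (inj₁ (≡ᵇ-true⁻ b))
...   | inj₂ e″ with ∨-true⁻ _ e″
...     | inj₁ c = let c₁ , c₂ = ∧-true⁻ _ c in inj₁ (inj₂ (≡ᵇ-true⁻ c₁ , ≡ᵇ-true⁻ c₂))
...     | inj₂ d = let d₁ , d₂ = ∧-true⁻ _ d in inj₂ (inj₂ (≡ᵇ-true⁻ d₁ , ≡ᵇ-true⁻ d₂))

cycAdj-true⁺ : ∀ {n} (i j : Fin n) →
  Precedes n (toℕ i) (toℕ j) ⊎ Precedes n (toℕ j) (toℕ i) → cycAdj n i j ≡ true
cycAdj-true⁺ {n} i j = disjunct
  where
  i→j = suc (toℕ i) ≡ᵇ toℕ j
  j→i = suc (toℕ j) ≡ᵇ toℕ i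
  i↺j = (suc (toℕ i) ≡ᵇ n) ∧ (toℕ j ≡ᵇ 0)
  j↺i = (suc (toℕ j) ≡ᵇ n) ∧ (toℕ i ≡ᵇ 0)
  disjunct : Precedes n (toℕ i) (toℕ j) ⊎ Precedes n (toℕ j) (toℕ i) → i→j ∨ j→i ∨ i↺j ∨ j↺i ≡ true
  disjunct (inj₁ (inj₁ a)) = ∨-true⁺ˡ (j→i ∨ i↺j ∨ j↺i) (≡ᵇ-true⁺ a)
  disjunct (inj₂ (inj₁ b)) = ∨-true⁺ʳ i→j (∨-true⁺ˡ (i↺j ∨ j↺i) (≡ᵇ-true⁺ b))
  disjunct (inj₁ (inj₂ (c₁ , c₂))) =
    ∨-true⁺ʳ i→j (∨-true⁺ʳ j→i (∨-true⁺ˡ j↺i (∧-true⁺ (≡ᵇ-true⁺ c₁) (≡ᵇ-true⁺ c₂))))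
  disjunct (inj₂ (inj₂ (d₁ , d₂))) =
    ∨-true⁺ʳ i→j (∨-true⁺ʳ j→i (∨-true⁺ʳ i↺j (∧-true⁺ (≡ᵇ-true⁺ d₁) (≡ᵇ-true⁺ d₂))))

C-Adj⇒prev : ∀ {n} {i j : Fin n} → Adj (C n) i j → i ≡ prev j ⊎ j ≡ prev i
C-Adj⇒prev {i = i} {j} = Sum.map precedes⇒≡prev precedes⇒≡prev ∘ cycAdj-true⁻ i j

C-loopless : ∀ {n} → 2 ≤ n → Loopless (C n)
C-loopless 2≤n i = ¬-not (Sum.[ precedes-irrefl 2≤n , precedes-irrefl 2≤n ] ∘ cycAdj-true⁻ i i)

C-twoRegular : ∀ {n} → 3 ≤ n → TwoRegular (C n)
C-twoRegular {n} 3≤n i = record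
  { x₁ = prev i
  ; x₂ = next i
  ; x₁≢x₂ = λ e → precedes-asym 3≤n (prev-precedes i)
                    (subst (Precedes n (toℕ i) ∘ toℕ) (sym e) (next-precedes i))
  ; px₁ = cycAdj-true⁺ i (prev i) (inj₂ (prev-precedes i))
  ; px₂ = cycAdj-true⁺ i (next i) (inj₁ (next-precedes i))
  ; exhaust = λ {j} e → Sum.swap (Sum.map precedes⇒≡next precedes⇒≡prev (cycAdj-true⁻ i j e))
  }

twoRegular-reflects : (G H : Graph) → TwoRegular G → TwoRegular H →
  (f : V G → V H) → (∀ {x y} → f x ≡ f y → x ≡ y) →
  (∀ x y → Adj G x y → Adj H (f x) (f y)) →
  ∀ x y → Adj H (f x) (f y) → Adj G x y
twoRegular-reflects G H regG regH f injective hom x y e =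
  Sum.[ reached px₁ , reached px₂ ]
    (exactlyTwo-exhaustedBy (regH (f x)) (hom x x₁ px₁) (hom x x₂ px₂) (x₁≢x₂ ∘ injective) e)
  where
  open ExactlyTwo (regG x)
  reached : ∀ {z} → Adj G x z → f y ≡ f z → Adj G x y
  reached xz fy≡fz = subst (Adj G x) (sym (injective fy≡fz)) xz

module CycleRecognition (H : Graph) (connected : Connected H) (loopless : Loopless H)
                        (twoRegular : TwoRegular H) where

  n : ℕ
  n = size H

  start : V H
  start = proj₁ connected

  record Step : Set where
    field
      current ahead : V H
      edge          : Adj H current ahead

  onward : (σ : Step) → Σ (V H) λ w → Adj H (Step.ahead σ) w × w ≢ Step.current σ ×
             (∀ {v} → Adj H (Step.ahead σ) v → v ≡ Step.current σ ⊎ v ≡ w)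
  onward σ = exactlyTwo-other (twoRegular (Step.ahead σ)) (Adj-sym H (Step.edge σ))

  walk : ℕ → Step
  walk zero    = record { current = start ; ahead = x₁ ; edge = px₁ }
    where open ExactlyTwo (twoRegular start)
  walk (suc t) = record { current = Step.ahead (walk t)
                        ; ahead   = proj₁ (onward (walk t))
                        ; edge    = proj₁ (proj₂ (onward (walk t))) }

  s : ℕ → V H
  s t = Step.current (walk t)

  s-adj : ∀ t → Adj H (s t) (s (suc t))
  s-adj t = Step.edge (walk t)

  s-turns : ∀ t → s (suc (suc t)) ≢ s t
  s-turns t = proj₁ (proj₂ (proj₂ (onward (walk t))))

  s-nbrs : ∀ t {w} → Adj H (s (suc t)) w → w ≡ s t ⊎ w ≡ s (suc (suc t))
  s-nbrs t = proj₂ (proj₂ (proj₂ (onward (walk t))))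

  start-nbrs : ∀ {w} → Adj H (s 0) w → w ≡ s 1 ⊎ w ≡ ExactlyTwo.x₂ (twoRegular start)
  start-nbrs = ExactlyTwo.exhaust (twoRegular start)

  DistinctUpTo : ℕ → Set
  DistinctUpTo t = ∀ {i j} → i ≤ t → j ≤ t → s i ≡ s j → i ≡ j

  record VisitedBy (t : ℕ) (v : V H) : Set where
    constructor visited
    field
      time    : ℕ
      time≤t  : time ≤ t
      s-time  : s time ≡ v
  open VisitedBy

  first-repeat : ∀ {t j} → DistinctUpTo t → j ≤ t → s (suc t) ≡ s j → j ≡ 0 × 2 ≤ t
  first-repeat {t} {j} distinct j≤t e with ℕ.m≤n⇒m<n∨m≡n j≤t
  ... | inj₂ refl = ⊥-elim (loopless⇒¬Adj H loopless (subst (Adj H (s j)) e (s-adj j)))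
  ... | inj₁ j<t with ℕ.m≤n⇒m<n∨m≡n j<t
  ...   | inj₂ refl = ⊥-elim (s-turns j e)
  ...   | inj₁ 2+j≤t with j
  ...     | zero   = refl , 2+j≤t
  ...     | suc j′ =
    ⊥-elim (Sum.[ back , forth ] (s-nbrs j′ (subst (λ v → Adj H v (s t)) e (Adj-sym H (s-adj t)))))
    where
    back : s t ≡ s j′ → _
    back e′ = ℕ.<-irrefl (sym (distinct ℕ.≤-refl (ℕ.≤-trans (ℕ.n≤1+n j′) (ℕ.<⇒≤ j<t)) e′))
                         (ℕ.<-trans (ℕ.n<1+n j′) j<t)
    forth : s t ≡ s (suc (suc j′)) → _
    forth e′ = ℕ.<-irrefl (sym (distinct ℕ.≤-refl (ℕ.<⇒≤ 2+j≤t) e′)) 2+j≤t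

  extend : ∀ {t} → DistinctUpTo t → (∀ {j} → j ≤ t → s (suc t) ≢ s j) → DistinctUpTo (suc t)
  extend {t} distinct new {i} {j} i≤1+t j≤1+t e
    with ℕ.m≤n⇒m<n∨m≡n i≤1+t | ℕ.m≤n⇒m<n∨m≡n j≤1+t
  ... | inj₂ refl | inj₂ refl = refl
  ... | inj₂ refl | inj₁ j<1+t = ⊥-elim (new (ℕ.≤-pred j<1+t) e)
  ... | inj₁ i<1+t | inj₂ refl = ⊥-elim (new (ℕ.≤-pred i<1+t) (sym e))
  ... | inj₁ i<1+t | inj₁ j<1+t = distinct (ℕ.≤-pred i<1+t) (ℕ.≤-pred j<1+t) e

  extend-or-return : ∀ {t} → DistinctUpTo t → DistinctUpTo (suc t) ⊎ (2 ≤ t × s (suc t) ≡ s 0)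
  extend-or-return {t} distinct with vertex-≟ H (s (suc t)) (s 0)
  ... | yes returned = inj₂ (proj₂ (first-repeat distinct z≤n returned) , returned)
  ... | no ¬returned = inj₁ (extend distinct λ j≤t e →
          ¬returned (subst (λ k → s (suc t) ≡ s k) (proj₁ (first-repeat distinct j≤t e)) e))

  returned⇒visits-all : ∀ {t} → DistinctUpTo t → 2 ≤ t → s (suc t) ≡ s 0 → ∀ v → VisitedBy t v
  returned⇒visits-all {t} distinct 2≤t returned v =
    walk-closed H visited-closed (proj₂ connected start v) (visited 0 z≤n refl)
    where
    1≤t : 1 ≤ t
    1≤t = ℕ.≤-trans (ℕ.n≤1+n 1) 2≤t

    last≡x₂ : s t ≡ ExactlyTwo.x₂ (twoRegular start)
    last≡x₂ with start-nbrs (subst (λ v → Adj H v (s t)) returned (Adj-sym H (s-adj t)))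
    ... | inj₁ st≡s1 = ⊥-elim (ℕ.<-irrefl (sym (distinct ℕ.≤-refl 1≤t st≡s1)) 2≤t)
    ... | inj₂ st≡x₂ = st≡x₂

    visited-closed : ∀ {v w} → Adj H v w → VisitedBy t v → VisitedBy t w
    visited-closed e (visited zero _ refl) with start-nbrs e
    ... | inj₁ refl = visited 1 1≤t refl
    ... | inj₂ refl = visited t ℕ.≤-refl last≡x₂
    visited-closed e (visited (suc i) 1+i≤t refl) with s-nbrs i e
    ... | inj₁ refl = visited i (ℕ.≤-trans (ℕ.n≤1+n i) 1+i≤t) refl
    ... | inj₂ refl with ℕ.m≤n⇒m<n∨m≡n 1+i≤t
    ...   | inj₁ 2+i≤t = visited (suc (suc i)) 2+i≤t refl
    ...   | inj₂ refl  = visited 0 z≤n (sym returned)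

  distinct⇒< : ∀ {t} → DistinctUpTo t → t < n
  distinct⇒< {t} distinct = injective⇒≤ {f = Inverse.from (enum H) ∘ s ∘ toℕ {suc t}} injective
    where
    injective : ∀ {i j} → Inverse.from (enum H) (s (toℕ i)) ≡ Inverse.from (enum H) (s (toℕ j)) → i ≡ j
    injective {i} {j} e = toℕ-injective (distinct (toℕ≤pred[n]′ i) (toℕ≤pred[n]′ j)
      (Injection.injective (↔⇒↣ (↔-sym (enum H))) e))

  visits-all⇒≤ : ∀ {t} → (∀ v → VisitedBy t v) → n ≤ suc t
  visits-all⇒≤ {t} visits = injective⇒≤ {f = index} injective
    where
    index : Fin n → Fin (suc t)
    index k = fromℕ< (s≤s (time≤t (visits (Inverse.to (enum H) k))))
    visited-at : ∀ k → s (toℕ (index k)) ≡ Inverse.to (enum H) k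
    visited-at k = trans (cong s (toℕ-fromℕ< (s≤s (time≤t (visits _))))) (s-time (visits _))
    injective : ∀ {k l} → index k ≡ index l → k ≡ l
    injective {k} {l} e = Injection.injective (↔⇒↣ (enum H))
      (trans (sym (visited-at k)) (trans (cong (s ∘ toℕ) e) (visited-at l)))

  distinct-step : ∀ {t} → DistinctUpTo t → suc t < n → DistinctUpTo (suc t)
  distinct-step distinct 1+t<n with extend-or-return distinct
  ... | inj₁ distinct′ = distinct′
  ... | inj₂ (2≤t , returned) =
    ⊥-elim (ℕ.<⇒≱ 1+t<n (visits-all⇒≤ (returned⇒visits-all distinct 2≤t returned)))

  distinct-below : ∀ t → t < n → DistinctUpTo t
  distinct-below zero    _     z≤n z≤n _ = refl
  distinct-below (suc t) 1+t<n = distinct-step (distinct-below t (ℕ.<-trans (ℕ.n<1+n t) 1+t<n)) 1+t<n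

  m : ℕ
  m = pred n

  1+m≡n : suc m ≡ n
  1+m≡n = ℕ.suc-pred n {{nonZeroIndex (Inverse.from (enum H) start)}}

  m<n : m < n
  m<n = subst (m <_) 1+m≡n (ℕ.n<1+n m)

  distinct : DistinctUpTo m
  distinct = distinct-below m m<n

  returns : 2 ≤ m × s (suc m) ≡ s 0
  returns with extend-or-return distinct
  ... | inj₁ distinct′ = ⊥-elim (ℕ.<-irrefl 1+m≡n (distinct⇒< distinct′))
  ... | inj₂ r         = r

  3≤n : 3 ≤ n
  3≤n = subst (3 ≤_) 1+m≡n (s≤s (proj₁ returns))

  wraps : ∀ {a} → suc a ≡ n → s (suc a) ≡ s 0
  wraps e = trans (cong (s ∘ suc) (ℕ.suc-injective (trans e (sym 1+m≡n)))) (proj₂ returns)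

  visits-all : ∀ v → VisitedBy m v
  visits-all = returned⇒visits-all distinct (proj₁ returns) (proj₂ returns)

  ι : Fin n → V H
  ι k = s (toℕ k)

  ι-injective : ∀ {k l} → ι k ≡ ι l → k ≡ l
  ι-injective {k} {l} e = toℕ-injective (distinct (toℕ≤pred[n]′ k) (toℕ≤pred[n]′ l) e)

  position : V H → Fin n
  position v = fromℕ< (ℕ.≤-<-trans (time≤t (visits-all v)) m<n)

  ι-position : ∀ v → ι (position v) ≡ v
  ι-position v =
    trans (cong s (toℕ-fromℕ< (ℕ.≤-<-trans (time≤t (visits-all v)) m<n))) (s-time (visits-all v))

  ι↔ : Fin n ↔ V H
  ι↔ = mk↔ₛ′ ι position ι-position (λ k → ι-injective (ι-position (ι k)))

  ι-prev : ∀ k → Adj H (ι (prev k)) (ι k)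
  ι-prev k with prev-precedes k
  ... | inj₁ e         = subst (Adj H (ι (prev k)) ∘ s) e (s-adj (toℕ (prev k)))
  ... | inj₂ (e₁ , e₂) =
    subst (Adj H (ι (prev k))) (trans (wraps e₁) (cong s (sym e₂))) (s-adj (toℕ (prev k)))

  ι-hom : ∀ k l → Adj (C n) k l → Adj H (ι k) (ι l)
  ι-hom k l e with C-Adj⇒prev {i = k} {l} e
  ... | inj₁ refl = ι-prev l
  ... | inj₂ refl = Adj-sym H (ι-prev k)

  C≅ : C n ≅ H
  C≅ = ι↔ , λ k l → ⇔→≡ (mk⇔ (ι-hom k l)
         (twoRegular-reflects (C n) H (C-twoRegular 3≤n) twoRegular ι ι-injective ι-hom k l))

connected-twoRegular≅C : (H : Graph) → Connected H → Loopless H → TwoRegular H → C (size H) ≅ H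
connected-twoRegular≅C = CycleRecognition.C≅

Independent : (G : Graph) {n : ℕ} → (V G → Fin n) → Set
Independent G L = ∀ x y → L x ≡ L y → adj G x y ≡ false

EdgeBetween : (G : Graph) {A : Set} → (V G → A) → A → A → Set
EdgeBetween G f a b = Σ (V G) λ x → Σ (V G) λ y → f x ≡ a × f y ≡ b × adj G x y ≡ true

edgeBetween-sym : (G : Graph) {A : Set} (f : V G → A) →
  ∀ {a b} → EdgeBetween G f a b → EdgeBetween G f b a
edgeBetween-sym G f (x , y , fx≡a , fy≡b , xy) = y , x , fy≡b , fx≡a , Adj-sym G xy

edgeBetween? : (G : Graph) {k : ℕ} (f : V G → Fin k) → ∀ a b → Dec (EdgeBetween G f a b)
edgeBetween? G f a b = vertex-any? G λ x → vertex-any? G λ y →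
  (f x Fin.≟ a) ×-dec (f y Fin.≟ b) ×-dec (adj G x y Bool.≟ true)

quotient : (G : Graph) {k : ℕ} → (V G → Fin k) → Graph
quotient G {k} f = record
  { V = Fin k ; size = k ; enum = ↔-id (Fin k)
  ; adj = λ a b → ⌊ edgeBetween? G f a b ⌋
  ; adj-sym = λ a b → ⇔→≡ (mk⇔ (flip a b) (flip b a))
  }
  where
  flip : ∀ a b → ⌊ edgeBetween? G f a b ⌋ ≡ true → ⌊ edgeBetween? G f b a ⌋ ≡ true
  flip a b = from (isYes⇔ _) ∘ edgeBetween-sym G f ∘ to (isYes⇔ _)

module _ (G : Graph) {k : ℕ} (f : V G → Fin k) where

  quotient-Adj⇔ : ∀ {a b} → Adj (quotient G f) a b ⇔ EdgeBetween G f a b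
  quotient-Adj⇔ {a} {b} = isYes⇔ (edgeBetween? G f a b)

  quotient-hom : ∀ x y → Adj G x y → Adj (quotient G f) (f x) (f y)
  quotient-hom x y xy = from quotient-Adj⇔ (x , y , refl , refl , xy)

  quotient-loopless : Independent G f → Loopless (quotient G f)
  quotient-loopless independent a = ¬-not loop
    where
    loop : ¬ Adj (quotient G f) a a
    loop e with x , y , fx≡a , fy≡a , xy ← to quotient-Adj⇔ e
      with () ← trans (sym xy) (independent x y (trans fx≡a (sym fy≡a)))

  quotient-connected : (∀ a → Σ (V G) λ x → f x ≡ a) → Connected G → Connected (quotient G f)
  quotient-connected onto (z , walks) = f z , λ a b →
    subst₂ (Walk (quotient G f)) (proj₂ (onto a)) (proj₂ (onto b))
      (walk-map G (quotient G f) f quotient-hom (walks (proj₁ (onto a)) (proj₁ (onto b))))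

Grid : (G : Graph) {k n : ℕ} → (V G → Fin k) → (V G → Fin n) → Set
Grid G P L = ∀ p i → Σ (V G) λ x → (P x ≡ p × L x ≡ i) × (∀ y → P y ≡ p → L y ≡ i → y ≡ x)

LiftsEdges : (G : Graph) {k n : ℕ} → (V G → Fin k) → (V G → Fin n) → Set
LiftsEdges G P L = ∀ p q i j → EdgeBetween G P p q → EdgeBetween G L i j →
  Σ (V G) λ x → Σ (V G) λ y → (P x ≡ p × L x ≡ i) × (P y ≡ q × L y ≡ j) × adj G x y ≡ true

ZeroOrTwoRegular : (G : Graph) {k : ℕ} → (V G → Fin k) → Set
ZeroOrTwoRegular G P = ∀ p q → Σ ℕ λ d → (d ≡ 0 ⊎ d ≡ 2) × (∀ x → P x ≡ p → nbrCount G P x q ≡ d)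

zeroOrTwoRegular⇒exactlyTwo : (G : Graph) {k : ℕ} {P : V G → Fin k} → ZeroOrTwoRegular G P →
  ∀ {x q y} → NbrIn G P x q y → ExactlyTwo (NbrIn G P x q)
zeroOrTwoRegular⇒exactlyTwo G {P = P} counts {x} {q} {y} nbr with counts (P x) q
... | _ , inj₁ refl , count = ⊥-elim (to (nbrCount≡0⇔ G P x q) (count x refl) y nbr)
... | _ , inj₂ refl , count = to (nbrCount≡2⇔ G P x q) (count x refl)

module Cells (G : Graph) {k n : ℕ} (P : V G → Fin k) (L : V G → Fin n) (grid : Grid G P L) where

  cell : Fin k → Fin n → V G
  cell p i = proj₁ (grid p i)

  cell-P : ∀ {p i} → P (cell p i) ≡ p
  cell-P {p} {i} = proj₁ (proj₁ (proj₂ (grid p i)))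

  cell-L : ∀ {p i} → L (cell p i) ≡ i
  cell-L {p} {i} = proj₂ (proj₁ (proj₂ (grid p i)))

  cell-unique : ∀ {p i y} → P y ≡ p → L y ≡ i → y ≡ cell p i
  cell-unique {p} {i} {y} = proj₂ (proj₂ (grid p i)) y

  cell-η : ∀ y → cell (P y) (L y) ≡ y
  cell-η y = sym (cell-unique refl refl)

grid≅quotient⊗quotient : (G : Graph) {k n : ℕ} (P : V G → Fin k) (L : V G → Fin n) →
  Grid G P L → LiftsEdges G P L → G ≅ (quotient G P ⊗ quotient G L)
grid≅quotient⊗quotient G P L grid lifts =
  mk↔ₛ′ (λ x → P x , L x) (λ (p , i) → cell p i) (λ (p , i) → cong₂ _,_ (cell-P {p} {i}) cell-L) cell-η ,
  λ x y → ⇔→≡ (mk⇔ (λ xy → ∧-true⁺ (quotient-hom G P x y xy) (quotient-hom G L x y xy)) (reflect x y))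
  where
  open Cells G P L grid

  reflect : ∀ x y → adj (quotient G P) (P x) (P y) ∧ adj (quotient G L) (L x) (L y) ≡ true → Adj G x y
  reflect x y e with P-edge , L-edge ← ∧-true⁻ _ e
    with x′ , y′ , (Px′ , Lx′) , (Py′ , Ly′) , x′y′ ←
           lifts (P x) (P y) (L x) (L y) (to (quotient-Adj⇔ G P) P-edge) (to (quotient-Adj⇔ G L) L-edge)
    = subst₂ (Adj G) (trans (cell-unique Px′ Lx′) (cell-η x))
                     (trans (cell-unique Py′ Ly′) (cell-η y)) x′y′

module FactoredGrid (Γ : Graph) {k n : ℕ} (P : V Γ → Fin k) (L : V Γ → Fin n) (3≤n : 3 ≤ n)
  (grid : Grid Γ P L) (A : Fin k → Fin k → Bool)
  (factors : ∀ x y → adj Γ x y ≡ A (P x) (P y) ∧ cycAdj n (L x) (L y)) where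

  open Cells Γ P L grid

  factors-true : ∀ {x y} → Adj Γ x y → A (P x) (P y) ≡ true × Adj (C n) (L x) (L y)
  factors-true {x} {y} xy = ∧-true⁻ _ (trans (sym (factors x y)) xy)

  cells-adj : ∀ {p q i j} → A p q ≡ true → Adj (C n) i j → Adj Γ (cell p i) (cell q j)
  cells-adj {p} {q} {i} {j} a c = begin
    adj Γ (cell p i) (cell q j)
      ≡⟨ factors _ _ ⟩
    A (P (cell p i)) (P (cell q j)) ∧ cycAdj n (L (cell p i)) (L (cell q j))
      ≡⟨ cong₂ _∧_ (cong₂ A cell-P cell-P) (cong₂ (cycAdj n) cell-L cell-L) ⟩
    A p q ∧ cycAdj n i j
      ≡⟨ cong₂ _∧_ a c ⟩
    true
      ∎
    where open ≡-Reasoning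

  independent : Independent Γ L
  independent x y Lx≡Ly = ¬-not λ xy → loopless⇒¬Adj (C n) (C-loopless (ℕ.<⇒≤ 3≤n)) {L x}
    (subst (Adj (C n) (L x)) (sym Lx≡Ly) (proj₂ (factors-true xy)))

  lifts : LiftsEdges Γ P L
  lifts p q i j (x , y , refl , refl , xy) (x′ , y′ , refl , refl , x′y′) =
    cell p i , cell q j , (cell-P , cell-L) , (cell-P , cell-L) ,
    cells-adj (proj₁ (factors-true xy)) (proj₂ (factors-true x′y′))

  no-nbrs : ∀ {p q} → A p q ≡ false → ∀ {x} → P x ≡ p → ∀ y → ¬ NbrIn Γ P x q y
  no-nbrs Apq≡false refl y (xy , refl) with () ← trans (sym (proj₁ (factors-true xy))) Apq≡false

  nbrs-exactlyTwo : ∀ {p q} → A p q ≡ true → ∀ {x} → P x ≡ p → ExactlyTwo (NbrIn Γ P x q)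
  nbrs-exactlyTwo {q = q} Apq {x} refl =
    exactlyTwo-image (cell q) (λ _ _ e → trans (sym cell-L) (trans (cong L e) cell-L))
      (λ c → subst (λ v → Adj Γ v (cell q _)) (cell-η x) (cells-adj Apq c) , cell-P)
      (λ (xy , Py≡q) → _ , proj₂ (factors-true xy) , sym (cell-unique Py≡q refl))
      (C-twoRegular 3≤n (L x))

  counts : ZeroOrTwoRegular Γ P
  counts p q with A p q in Apq
  ... | false = 0 , inj₁ refl , λ x Px≡p → from (nbrCount≡0⇔ Γ P x q) (no-nbrs Apq Px≡p)
  ... | true  = 2 , inj₂ refl , λ x Px≡p → from (nbrCount≡2⇔ Γ P x q) (nbrs-exactlyTwo Apq Px≡p)

  decomposition : Decomposition Γ n
  decomposition = L , k , P , independent , grid , lifts , counts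

product⇒decomposition : (Γ Δ : Graph) {n : ℕ} → 3 ≤ n → Γ ≅ (Δ ⊗ C n) → Decomposition Γ n
product⇒decomposition Γ Δ {n} 3≤n (f , pres) =
  FactoredGrid.decomposition Γ P L 3≤n grid (λ p q → adj Δ (toΔ p) (toΔ q)) factors
  where
  open Inverse f using (strictlyInverseˡ; strictlyInverseʳ) renaming (to to φ; from to φ⁻¹)
  open Inverse (enum Δ) using ()
    renaming (to to toΔ; from to fromΔ; strictlyInverseˡ to toΔ-fromΔ; strictlyInverseʳ to fromΔ-toΔ)

  P : V Γ → Fin (size Δ)
  P x = fromΔ (proj₁ (φ x))

  L : V Γ → Fin n
  L x = proj₂ (φ x)

  grid : Grid Γ P L
  grid p i = φ⁻¹ (toΔ p , i) , (P-cell , L-cell) , unique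
    where
    P-cell : P (φ⁻¹ (toΔ p , i)) ≡ p
    P-cell = trans (cong (fromΔ ∘ proj₁) (strictlyInverseˡ _)) (fromΔ-toΔ p)
    L-cell : L (φ⁻¹ (toΔ p , i)) ≡ i
    L-cell = cong proj₂ (strictlyInverseˡ _)
    unique : ∀ y → P y ≡ p → L y ≡ i → y ≡ φ⁻¹ (toΔ p , i)
    unique y refl refl =
      trans (sym (strictlyInverseʳ y)) (cong (λ u → φ⁻¹ (u , L y)) (sym (toΔ-fromΔ _)))

  factors : ∀ x y → adj Γ x y ≡ adj Δ (toΔ (P x)) (toΔ (P y)) ∧ cycAdj n (L x) (L y)
  factors x y = trans (pres x y)
    (cong₂ (λ u v → adj Δ u v ∧ cycAdj n (L x) (L y)) (sym (toΔ-fromΔ _)) (sym (toΔ-fromΔ _)))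

another : ∀ {n} → 2 ≤ n → (i : Fin n) → Σ (Fin n) (_≢ i)
another (s≤s (s≤s _)) i = punchIn i Fin.zero , punchInᵢ≢i i Fin.zero

quotient-twoRegular : (Γ : Graph) {k n : ℕ} (P : V Γ → Fin k) (L : V Γ → Fin n) →
  Connected Γ → 2 ≤ n → Grid Γ P L → LiftsEdges Γ P L → ZeroOrTwoRegular Γ P →
  TwoRegular (quotient Γ L)
quotient-twoRegular Γ P L connected 2≤n grid lifts counts i =
  subst (ExactlyTwo ∘ Adj (quotient Γ L)) cell-L (labels-around (cell (P (proj₁ connected)) i))
  where
  open Cells Γ P L grid

  neighbour : ∀ x → Σ (V Γ) (Adj Γ x)
  neighbour x = walk-first-step Γ (proj₂ connected x x′) λ x≡x′ →
    j≢Lx (trans (sym cell-L) (cong L (sym x≡x′)))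
    where
    j = proj₁ (another 2≤n (L x))
    j≢Lx = proj₂ (another 2≤n (L x))
    x′ = cell (P x) j

  labels-around : ∀ x → ExactlyTwo (Adj (quotient Γ L) (L x))
  labels-around x =
    exactlyTwo-image L
      (λ (_ , Pw≡q) (_ , Pw′≡q) Lw≡Lw′ →
         trans (cell-unique Pw≡q refl) (sym (cell-unique Pw′≡q (sym Lw≡Lw′))))
      (λ (xw , _) → quotient-hom Γ L x _ xw)
      onto
      (zeroOrTwoRegular⇒exactlyTwo Γ counts (proj₂ (neighbour x) , refl))
    where
    y = proj₁ (neighbour x)
    onto : ∀ {j} → Adj (quotient Γ L) (L x) j → Σ (V Γ) λ w → NbrIn Γ P x (P y) w × L w ≡ j
    onto {j} e with x′ , w , (Px′ , Lx′) , (Pw , Lw) , x′w ←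
                      lifts (P x) (P y) (L x) j (x , y , refl , refl , proj₂ (neighbour x))
                            (to (quotient-Adj⇔ Γ L) e)
      = w , (subst (λ v → Adj Γ v w) (trans (cell-unique Px′ Lx′) (cell-η x)) x′w , Pw) , Lw

decomposition⇒product : (Γ : Graph) {n : ℕ} → Connected Γ → 2 ≤ n → Decomposition Γ n →
  Σ Graph λ Δ → Γ ≅ (Δ ⊗ C n)
decomposition⇒product Γ {n} connected 2≤n (L , k , P , independent , grid , lifts , counts) =
  QP , ≅-trans {Γ} {QP ⊗ QL} {QP ⊗ C n} (grid≅quotient⊗quotient Γ P L grid lifts)
                                        (⊗-congʳ {QP} {QL} {C n} (≅-sym {C n} {QL} cycle))
  where
  open Cells Γ P L grid
  QP = quotient Γ P
  QL = quotient Γ L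
  cycle : C n ≅ QL
  cycle = connected-twoRegular≅C QL
    (quotient-connected Γ L (λ i → cell (P (proj₁ connected)) i , cell-L) connected)
    (quotient-loopless Γ L independent)
    (quotient-twoRegular Γ P L connected 2≤n grid lifts counts)

lemma4p2 : (Γ : Graph) → Connected Γ → (n : ℕ) → n ≥ 3 →
    ((Σ Graph λ Δ → Γ ≅ (Δ ⊗ C n)) ⇔ Decomposition Γ n)
lemma4p2 Γ connected n 3≤n =
  mk⇔ (λ (Δ , iso) → product⇒decomposition Γ Δ 3≤n iso)
      (decomposition⇒product Γ connected (ℕ.<⇒≤ 3≤n))
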